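{- Let $n\geq 3$ be an odd integer and $k\geq 3$ an integer. Then the minimum size of a resolving set of vertices of $(C_n\Box P_k)\Box P_2$ is $3$, i.e. $\beta((C_n\Box P_k)\Box P_2)=3$.
   Context: $C_n$ denotes the cycle on $n$ vertices and $P_k$ the path on $k$ vertices. For graphs $G,H$, the Cartesian product $G\Box H$ has vertex set $V(G)\times V(H)$, with $(g_1,h_1)$ adjacent to $(g_2,h_2)$ iff either $h_1=h_2$ and $g_1g_2\in E(G)$, or $g_1=g_2$ and $h_1h_2\in E(H)$. For a connected graph $G$ and an ordered set $Q=\{q_1,\dots,q_l\}\subseteq V(G)$, $r(x|Q)=(d(x,q_1),\dots,d(x,q_l))$, where $d$ is the shortest-path distance. $Q$ is a resolving set if distinct vertices have distinct representations $r(\cdot|Q)$. $\beta(G)$ (the metric dimension) is the minimum size of a resolving set of $G$. -}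

module Defs where

open import Level using (0ℓ)
open import Data.Nat using (ℕ; zero; suc; _≤_; _%_)
open import Data.Fin using (Fin; toℕ)
open import Data.Product using (_×_; Σ; ∃; _,_)
open import Data.Sum using (_⊎_)
open import Relation.Binary.PropositionalEquality using (_≡_)
open import Function.Definitions using (Injective)

record Graph : Set₁ where
  field
    V   : Set
    Adj : V → V → Set
open Graph public

PathAdj : (k : ℕ) → Fin k → Fin k → Set
PathAdj k i j = (suc (toℕ i) ≡ toℕ j) ⊎ (suc (toℕ j) ≡ toℕ i)

P : ℕ → Graph
P k = record { V = Fin k ; Adj = PathAdj k }

CycSucc : (n : ℕ) → Fin n → Fin n → Set
CycSucc n i j = (suc (toℕ i) ≡ toℕ j) ⊎ ((suc (toℕ i) ≡ n) × (toℕ j ≡ 0))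

CycAdj : (n : ℕ) → Fin n → Fin n → Set
CycAdj n i j = CycSucc n i j ⊎ CycSucc n j i

C : ℕ → Graph
C n = record { V = Fin n ; Adj = CycAdj n }

_□_ : Graph → Graph → Graph
G □ H = record
  { V   = V G × V H
  ; Adj = λ { (g₁ , h₁) (g₂ , h₂) →
              ((h₁ ≡ h₂) × Adj G g₁ g₂) ⊎ ((g₁ ≡ g₂) × Adj H h₁ h₂) } }

data Walk (G : Graph) : V G → V G → ℕ → Set where
  here : ∀ {x} → Walk G x x zero
  step : ∀ {x y z m} → Adj G x y → Walk G y z m → Walk G x z (suc m)

Dist : (G : Graph) → V G → V G → ℕ → Set
Dist G x y m = Walk G x y m × (∀ m' → Walk G x y m' → m ≤ m')

SameRep : (G : Graph) {l : ℕ} → (Fin l → V G) → V G → V G → Set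
SameRep G Q x y = ∀ i a b → Dist G x (Q i) a → Dist G y (Q i) b → a ≡ b

Resolving : (G : Graph) {l : ℕ} → (Fin l → V G) → Set
Resolving G Q = ∀ x y → SameRep G Q x y → x ≡ y

MetricDim : Graph → ℕ → Set
MetricDim G b =
  (Σ (Fin b → V G) λ Q → Injective _≡_ _≡_ Q × Resolving G Q)
  × (∀ (l : ℕ) (Q : Fin l → V G) → Injective _≡_ _≡_ Q → Resolving G Q → b ≤ l)

-- Lower bound: every vertex q of C_n □ P_k □ P_2 (n ≥ 3, k ≥ 2) has four distinct
-- neighbours, and their distances to any vertex q' lie in {d(q,q') - 1, d(q,q'), d(q,q') + 1};
-- by pigeonhole two of them have the same distances to q and to q', so no two vertices resolve.
-- Upper bound, n = 2h + 1: distances add over the factors, so the landmarks (0,0,0) and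
-- (0,0,1) recover the P_2 coordinate, after which (0,0,0) and (h,0,0) recover the cycle
-- coordinate because a ↦ d(a,0) - d(a,h) is injective on C_{2h+1}; the P_k coordinate follows.
-- Distances in P_k and C_n are certified by a walk whose length matches a 1-Lipschitz potential.

module Submission where

open import Defs
open import Data.Nat using (ℕ; zero; suc; _+_; _*_; _∸_; _≤_; _<_; _⊓_; ∣_-_∣; z≤n; s≤s; _≤?_; _<?_; _%_; _/_)
open import Data.Nat.Properties
open import Data.Nat.DivMod using (m≡m%n+[m/n]*n)
open import Data.Nat.Tactic.RingSolver using (solve-∀)
open import Data.Fin using (Fin; toℕ; fromℕ<; fromℕ; inject₁) renaming (zero to fz; suc to fs)
import Data.Fin as Fin
open import Data.Fin.Properties using (toℕ-injective; toℕ<n; toℕ-fromℕ<; toℕ-fromℕ; toℕ-inject₁; pigeonhole)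
open import Data.Empty using (⊥; ⊥-elim)
open import Data.Product using (_×_; Σ; _,_; proj₁; proj₂)
open import Data.Sum using (_⊎_; inj₁; inj₂)
open import Relation.Nullary using (yes; no; contradiction)
open import Function using (_∘_)
open import Function.Definitions using (Injective)
open import Relation.Binary.PropositionalEquality using (_≡_; _≢_; refl; sym; trans; cong; cong₂; subst; module ≡-Reasoning)

Walk-++ : ∀ {G x y z m m'} → Walk G x y m → Walk G y z m' → Walk G x z (m + m')
Walk-++ here       w' = w'
Walk-++ (step a w) w' = step a (Walk-++ w w')

Walk-cast : ∀ {G x y m m'} → m ≡ m' → Walk G x y m → Walk G x y m'
Walk-cast refl w = w

Symmetric : Graph → Set
Symmetric G = ∀ {u v} → Adj G u v → Adj G v u

Walk-reverse : ∀ G → Symmetric G → ∀ {x y m} → Walk G x y m → Walk G y x m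
Walk-reverse G symm here = here
Walk-reverse G symm (step {m = m} a w) =
  Walk-cast (+-comm m 1) (Walk-++ (Walk-reverse G symm w) (step (symm a) here))

Walk-⊓ : ∀ {G x y m m'} → Walk G x y m → Walk G x y m' → Walk G x y (m ⊓ m')
Walk-⊓ {m = m} {m'} w w' with ⊓-sel m m'
... | inj₁ m⊓m'≡m  = Walk-cast (sym m⊓m'≡m) w
... | inj₂ m⊓m'≡m' = Walk-cast (sym m⊓m'≡m') w'

Dist-unique : ∀ {G x y a b} → Dist G x y a → Dist G x y b → a ≡ b
Dist-unique (w , min) (w' , min') = ≤-antisym (min _ w') (min' _ w)

Dist-adjacent : ∀ {G x y} → Adj G x y → x ≢ y → Dist G x y 1
Dist-adjacent a x≢y = step a here , λ { zero here → contradiction refl x≢y ; (suc m) _ → s≤s z≤n }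

1-Lipschitz : (G : Graph) → (V G → ℕ) → Set
1-Lipschitz G f = ∀ {u v} → Adj G u v → f u ≤ suc (f v)

Lipschitz-walk : ∀ G {f} → 1-Lipschitz G f → ∀ {x y m} → Walk G x y m → f x ≤ m + f y
Lipschitz-walk G lip here       = ≤-refl
Lipschitz-walk G lip (step a w) = ≤-trans (lip a) (s≤s (Lipschitz-walk G lip w))

Dist-by-potential : ∀ G {f} → 1-Lipschitz G f → ∀ {x y} → f y ≡ 0 → Walk G x y (f x) → Dist G x y (f x)
Dist-by-potential G {f} lip {x} fy≡0 w = w , λ m w' →
  subst (f x ≤_) (trans (cong (m +_) fy≡0) (+-identityʳ m)) (Lipschitz-walk G lip w')

IsDistance : (G : Graph) → (V G → V G → ℕ) → Set
IsDistance G d = ∀ x y → Dist G x y (d x y)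

IsDistance⇒SameRep : ∀ {G d} → IsDistance G d → ∀ {l} (Q : Fin l → V G) {x y} →
  (∀ i → d x (Q i) ≡ d y (Q i)) → SameRep G Q x y
IsDistance⇒SameRep dist Q {x} {y} eq i a b dx dy =
  trans (Dist-unique dx (dist x (Q i))) (trans (eq i) (Dist-unique (dist y (Q i)) dy))

SameRep⇒dist≡ : ∀ {G d} → IsDistance G d → ∀ {l} (Q : Fin l → V G) {x y} →
  SameRep G Q x y → ∀ i → d x (Q i) ≡ d y (Q i)
SameRep⇒dist≡ dist Q {x} {y} same i = same i _ _ (dist x (Q i)) (dist y (Q i))

□-symmetric : ∀ G H → Symmetric G → Symmetric H → Symmetric (G □ H)
□-symmetric G H symG symH (inj₁ (e , a)) = inj₁ (sym e , symG a)
□-symmetric G H symG symH (inj₂ (e , a)) = inj₂ (sym e , symH a)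

Walk-□ˡ : ∀ {G H g g' m} (h : V H) → Walk G g g' m → Walk (G □ H) (g , h) (g' , h) m
Walk-□ˡ h here       = here
Walk-□ˡ h (step a w) = step (inj₁ (refl , a)) (Walk-□ˡ h w)

Walk-□ʳ : ∀ {G H h h' m} (g : V G) → Walk H h h' m → Walk (G □ H) (g , h) (g , h') m
Walk-□ʳ g here       = here
Walk-□ʳ g (step a w) = step (inj₂ (refl , a)) (Walk-□ʳ g w)

Walk-□-split : ∀ {G H g g' h h' m} → Walk (G □ H) (g , h) (g' , h') m →
  Σ ℕ λ p → Σ ℕ λ q → Walk G g g' p × Walk H h h' q × p + q ≡ m
Walk-□-split here = 0 , 0 , here , here , refl
Walk-□-split (step (inj₁ (refl , a)) w) with Walk-□-split w
... | p , q , wG , wH , p+q≡m = suc p , q , step a wG , wH , cong suc p+q≡m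
Walk-□-split (step (inj₂ (refl , a)) w) with Walk-□-split w
... | p , q , wG , wH , p+q≡m = p , suc q , wG , step a wH , trans (+-suc p q) (cong suc p+q≡m)

Dist-□ : ∀ {G H g g' h h' a b} → Dist G g g' a → Dist H h h' b → Dist (G □ H) (g , h) (g' , h') (a + b)
Dist-□ {G} {H} {g} {g'} {h} {h'} {a} {b} (wG , minG) (wH , minH) =
  Walk-++ (Walk-□ˡ h wG) (Walk-□ʳ g' wH) , shortest
  where
  shortest : ∀ m → Walk (G □ H) (g , h) (g' , h') m → a + b ≤ m
  shortest m w with Walk-□-split w
  ... | p , q , wG' , wH' , p+q≡m = subst (a + b ≤_) p+q≡m (+-mono-≤ (minG p wG') (minH q wH'))

□-dist : (G H : Graph) → (V G → V G → ℕ) → (V H → V H → ℕ) → V (G □ H) → V (G □ H) → ℕ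
□-dist G H dG dH (g , h) (g' , h') = dG g g' + dH h h'

□-isDistance : ∀ {G H dG dH} → IsDistance G dG → IsDistance H dH → IsDistance (G □ H) (□-dist G H dG dH)
□-isDistance distG distH (g , h) (g' , h') = Dist-□ (distG g g') (distH h h')

Fin-graph : (n : ℕ) → (Fin n → Fin n → Set) → Graph
Fin-graph n A = record { V = Fin n ; Adj = A }

ascending-walk : ∀ {n} (A : Fin n → Fin n → Set) → (∀ {i j} → suc (toℕ i) ≡ toℕ j → A i j) →
  ∀ m {i j : Fin n} → toℕ j ≡ toℕ i + m → Walk (Fin-graph n A) i j m
ascending-walk A succ zero {i} {j} j≡i+0 =
  subst (λ j → Walk _ i j 0) (toℕ-injective (sym (trans j≡i+0 (+-identityʳ (toℕ i))))) here
ascending-walk {n} A succ (suc m) {i} {j} j≡i+1+m =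
  step (succ (sym (toℕ-fromℕ< i+1<n)))
       (ascending-walk A succ m (trans j≡i+1+m (trans (+-suc (toℕ i) m) (cong (_+ m) (sym (toℕ-fromℕ< i+1<n))))))
  where
  i+1<n : suc (toℕ i) < n
  i+1<n = begin-strict
    suc (toℕ i)      ≤⟨ s≤s (m≤m+n (toℕ i) m) ⟩
    suc (toℕ i + m)  ≡⟨ sym (trans j≡i+1+m (+-suc (toℕ i) m)) ⟩
    toℕ j            <⟨ toℕ<n j ⟩
    n                ∎
    where open ≤-Reasoning

successor-∣-∣≤1 : ∀ {m n} → suc m ≡ n ⊎ suc n ≡ m → ∣ m - n ∣ ≤ 1
successor-∣-∣≤1 {m} (inj₁ refl) = ≤-reflexive (trans (cong ∣ m -_∣ (+-comm 1 m)) (∣m-m+n∣≡n m 1))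
successor-∣-∣≤1 {n = n} (inj₂ refl) =
  ≤-reflexive (trans (∣-∣-comm (suc n) n) (trans (cong ∣ n -_∣ (+-comm 1 n)) (∣m-m+n∣≡n n 1)))

∣-∣-Lipschitz : ∀ u v j → ∣ u - v ∣ ≤ 1 → ∣ u - j ∣ ≤ suc ∣ v - j ∣
∣-∣-Lipschitz u v j u~v = ≤-trans (∣-∣-triangle u v j) (+-monoˡ-≤ ∣ v - j ∣ u~v)

P-symmetric : ∀ k → Symmetric (P k)
P-symmetric k (inj₁ e) = inj₂ e
P-symmetric k (inj₂ e) = inj₁ e

path-dist : ∀ {k} → Fin k → Fin k → ℕ
path-dist x y = ∣ toℕ x - toℕ y ∣

P-isDistance : ∀ k → IsDistance (P k) path-dist
P-isDistance k x j = Dist-by-potential (P k) lip (∣n-n∣≡0 (toℕ j)) walk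
  where
  lip : 1-Lipschitz (P k) (λ u → path-dist u j)
  lip {u} {v} u~v = ∣-∣-Lipschitz (toℕ u) (toℕ v) (toℕ j) (successor-∣-∣≤1 u~v)
  ascending : ∀ {i j : Fin k} → toℕ i ≤ toℕ j → Walk (P k) i j (toℕ j ∸ toℕ i)
  ascending i≤j = ascending-walk (PathAdj k) inj₁ _ (sym (m+[n∸m]≡n i≤j))
  walk : Walk (P k) x j (path-dist x j)
  walk with ≤-total (toℕ x) (toℕ j)
  ... | inj₁ x≤j = Walk-cast (sym (m≤n⇒∣m-n∣≡n∸m x≤j)) (ascending x≤j)
  ... | inj₂ j≤x = Walk-cast (sym (m≤n⇒∣n-m∣≡n∸m j≤x)) (Walk-reverse (P k) (P-symmetric k) (ascending j≤x))

cyc-dist : ℕ → ℕ → ℕ → ℕ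
cyc-dist n a j = ∣ a - j ∣ ⊓ (n ∸ ∣ a - j ∣)

C-symmetric : ∀ n → Symmetric (C n)
C-symmetric n (inj₁ e) = inj₂ e
C-symmetric n (inj₂ e) = inj₁ e

∸-Lipschitz : ∀ n {a b} → b ≤ suc a → n ∸ a ≤ suc (n ∸ b)
∸-Lipschitz n {a} {b} b≤1+a = begin
  suc n ∸ suc a    ≤⟨ ∸-monoʳ-≤ (suc n) b≤1+a ⟩
  suc n ∸ b        ≤⟨ m≤n+o⇒m∸n≤o (suc n) b (≤-trans (s≤s (m≤n+m∸n n b)) (≤-reflexive (sym (+-suc b (n ∸ b))))) ⟩
  suc (n ∸ b)      ∎
  where open ≤-Reasoning

cyc-dist-Lipschitz : ∀ n u v j → ∣ u - v ∣ ≤ 1 → cyc-dist n u j ≤ suc (cyc-dist n v j)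
cyc-dist-Lipschitz n u v j u~v =
  ⊓-mono-≤ (∣-∣-Lipschitz u v j u~v)
           (∸-Lipschitz n (∣-∣-Lipschitz v u j (subst (_≤ 1) (∣-∣-comm u v) u~v)))

⊓-suc-swap : ∀ p j → p ⊓ suc j ≤ suc (j ⊓ suc p)
⊓-suc-swap p j = subst (_≤ suc j ⊓ suc (suc p)) (⊓-comm (suc j) p)
                   (⊓-mono-≤ ≤-refl (m≤n⇒m≤1+n (n≤1+n p)))

-- Across the edge N ~ 0 the two arcs to j trade places, up to one step.
cyc-dist-wrap : ∀ N j → j ≤ N →
  cyc-dist (suc N) N j ≡ (N ∸ j) ⊓ suc j × cyc-dist (suc N) 0 j ≡ j ⊓ suc (N ∸ j)
cyc-dist-wrap N j j≤N =
  cong₂ (λ δ r → δ ⊓ r) (m≤n⇒∣n-m∣≡n∸m j≤N) far ,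
  cong (j ⊓_) (+-∸-assoc 1 j≤N)
  where
  far : suc N ∸ ∣ N - j ∣ ≡ suc j
  far = begin
    suc N ∸ ∣ N - j ∣    ≡⟨ cong (suc N ∸_) (m≤n⇒∣n-m∣≡n∸m j≤N) ⟩
    suc N ∸ (N ∸ j)      ≡⟨ +-∸-assoc 1 (m∸n≤m N j) ⟩
    suc (N ∸ (N ∸ j))    ≡⟨ cong suc (m∸[m∸n]≡n j≤N) ⟩
    suc j                ∎
    where open ≡-Reasoning

C-dist : ∀ {n} → Fin n → Fin n → ℕ
C-dist {n} x y = cyc-dist n (toℕ x) (toℕ y)

C-Lipschitz : ∀ N (j : Fin (suc N)) → 1-Lipschitz (C (suc N)) (λ u → C-dist u j)
C-Lipschitz N j {u} {v} (inj₁ (inj₁ e)) =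
  cyc-dist-Lipschitz (suc N) (toℕ u) (toℕ v) (toℕ j) (successor-∣-∣≤1 (inj₁ e))
C-Lipschitz N j {u} {v} (inj₂ (inj₁ e)) =
  cyc-dist-Lipschitz (suc N) (toℕ u) (toℕ v) (toℕ j) (successor-∣-∣≤1 (inj₂ e))
C-Lipschitz N j {u} {v} (inj₁ (inj₂ (e , v≡0))) rewrite suc-injective e | v≡0
  with cyc-dist-wrap N (toℕ j) (≤-pred (toℕ<n j))
... | eqN , eq0 rewrite eqN | eq0 = ⊓-suc-swap (N ∸ toℕ j) (toℕ j)
C-Lipschitz N j {u} {v} (inj₂ (inj₂ (e , u≡0))) rewrite suc-injective e | u≡0
  with cyc-dist-wrap N (toℕ j) (≤-pred (toℕ<n j))
... | eqN , eq0 rewrite eqN | eq0 = ⊓-suc-swap (toℕ j) (N ∸ toℕ j)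

wrap-length : ∀ {x j N} → x ≤ j → j ≤ N → x + suc (N ∸ j) ≡ suc N ∸ (j ∸ x)
wrap-length {x} {j} {N} x≤j j≤N = sym (begin
  suc N ∸ (j ∸ x)                                  ≡⟨ cong (λ t → suc t ∸ (j ∸ x)) N≡ ⟩
  suc (x + (j ∸ x) + (N ∸ j)) ∸ (j ∸ x)            ≡⟨ cong (_∸ (j ∸ x)) (rearrange x (j ∸ x) (N ∸ j)) ⟩
  x + suc (N ∸ j) + (j ∸ x) ∸ (j ∸ x)              ≡⟨ m+n∸n≡m (x + suc (N ∸ j)) (j ∸ x) ⟩
  x + suc (N ∸ j)                                  ∎)
  where
  open ≡-Reasoning
  N≡ : N ≡ x + (j ∸ x) + (N ∸ j)
  N≡ = trans (sym (m+[n∸m]≡n j≤N)) (cong (_+ (N ∸ j)) (sym (m+[n∸m]≡n x≤j)))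
  rearrange : ∀ a d e → suc (a + d + e) ≡ a + suc e + d
  rearrange = solve-∀

C-walk-ascending : ∀ {N} (x j : Fin (suc N)) → toℕ x ≤ toℕ j → Walk (C (suc N)) x j (C-dist x j)
C-walk-ascending {N} x j x≤j =
  Walk-cast (cong (λ δ → δ ⊓ (suc N ∸ δ)) (sym (m≤n⇒∣m-n∣≡n∸m x≤j)))
            (Walk-⊓ direct (Walk-cast (wrap-length x≤j j≤N) around))
  where
  j≤N : toℕ j ≤ N
  j≤N = ≤-pred (toℕ<n j)
  ascending : ∀ m {i i' : Fin (suc N)} → toℕ i' ≡ toℕ i + m → Walk (C (suc N)) i i' m
  ascending = ascending-walk (CycAdj (suc N)) (λ e → inj₁ (inj₁ e))
  descending : ∀ m {i i' : Fin (suc N)} → toℕ i ≡ toℕ i' + m → Walk (C (suc N)) i i' m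
  descending m e = Walk-reverse (C (suc N)) (C-symmetric (suc N)) (ascending m e)
  direct : Walk (C (suc N)) x j (toℕ j ∸ toℕ x)
  direct = ascending _ (sym (m+[n∸m]≡n x≤j))
  around : Walk (C (suc N)) x j (toℕ x + suc (N ∸ toℕ j))
  around = Walk-++ (descending (toℕ x) refl)
             (step (inj₂ (inj₂ (cong suc (toℕ-fromℕ N) , refl)))
                   (descending (N ∸ toℕ j) (trans (toℕ-fromℕ N) (sym (m+[n∸m]≡n j≤N)))))

C-isDistance : ∀ N → IsDistance (C (suc N)) C-dist
C-isDistance N x j = Dist-by-potential (C (suc N)) (C-Lipschitz N j)
  (cong (λ δ → δ ⊓ (suc N ∸ δ)) (∣n-n∣≡0 (toℕ j))) walk
  where
  walk : Walk (C (suc N)) x j (C-dist x j)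
  walk with ≤-total (toℕ x) (toℕ j)
  ... | inj₁ x≤j = C-walk-ascending x j x≤j
  ... | inj₂ j≤x = Walk-cast (cong (λ δ → δ ⊓ (suc N ∸ δ)) (∣-∣-comm (toℕ j) (toℕ x)))
                     (Walk-reverse (C (suc N)) (C-symmetric (suc N)) (C-walk-ascending j x j≤x))

record FourNeighbours (G : Graph) (q : V G) : Set where
  field
    nbr          : Fin 4 → V G
    nbr-adjacent : ∀ i → Adj G (nbr i) q
    nbr-≢        : ∀ i → nbr i ≢ q
    nbr-distinct : ∀ {i j} → i Fin.< j → nbr i ≢ nbr j

module _ (G : Graph) (G-sym : Symmetric G) {d : V G → V G → ℕ} (dist : IsDistance G d) where

  module _ {q : V G} (N : FourNeighbours G q) (q' : V G) where
    open FourNeighbours N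

    private
      nbr-dist≤ : ∀ i → d (nbr i) q' ≤ suc (d q q')
      nbr-dist≤ i = proj₂ (dist (nbr i) q') (suc (d q q')) (step (nbr-adjacent i) (proj₁ (dist q q')))

      nbr-dist≥ : ∀ i → d q q' ≤ suc (d (nbr i) q')
      nbr-dist≥ i = proj₂ (dist q q') (suc (d (nbr i) q')) (step (G-sym (nbr-adjacent i)) (proj₁ (dist (nbr i) q')))

      -- d (nbr i) q' lies in {d q q' - 1, d q q', d q q' + 1}; offset i records which.
      offset : Fin 4 → Fin 3
      offset i = fromℕ< {suc (d (nbr i) q') ∸ d q q'}
        (s≤s (m≤n+o⇒m∸n≤o (suc (d (nbr i) q')) (d q q')
                (≤-trans (s≤s (nbr-dist≤ i)) (≤-reflexive (+-comm 2 (d q q'))))))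

      offset-injective : ∀ i j → offset i ≡ offset j → d (nbr i) q' ≡ d (nbr j) q'
      offset-injective i j same = suc-injective (∸-cancelʳ-≡ (nbr-dist≥ i) (nbr-dist≥ j)
        (trans (sym (toℕ-fromℕ< _)) (trans (cong toℕ same) (toℕ-fromℕ< _))))

      nbr-dist-q : ∀ i → d (nbr i) q ≡ 1
      nbr-dist-q i = Dist-unique (dist (nbr i) q) (Dist-adjacent (nbr-adjacent i) (nbr-≢ i))

    twin-neighbours : Σ (V G) λ x → Σ (V G) λ y → x ≢ y × d x q ≡ d y q × d x q' ≡ d y q'
    twin-neighbours with pigeonhole (s≤s (s≤s (s≤s (s≤s z≤n)))) offset
    ... | i , j , i<j , same = nbr i , nbr j , nbr-distinct i<j ,
                               trans (nbr-dist-q i) (sym (nbr-dist-q j)) , offset-injective i j same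

  not-resolving : ∀ {l} (Q : Fin l → V G) {x y} → x ≢ y → (∀ i → d x (Q i) ≡ d y (Q i)) → Resolving G Q → ⊥
  not-resolving Q x≢y same resolving = x≢y (resolving _ _ (IsDistance⇒SameRep dist Q same))

  resolving-size≥3 : V G → (∀ q → FourNeighbours G q) → ∀ l (Q : Fin l → V G) → Resolving G Q → 3 ≤ l
  resolving-size≥3 v N zero Q resolving =
    ⊥-elim (not-resolving Q (FourNeighbours.nbr-distinct (N v) {fz} {fs fz} (s≤s z≤n)) (λ ()) resolving)
  resolving-size≥3 v N 1 Q resolving =
    let (x , y , x≢y , same , _) = twin-neighbours (N (Q fz)) (Q fz)
    in ⊥-elim (not-resolving Q x≢y (λ { fz → same }) resolving)
  resolving-size≥3 v N 2 Q resolving =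
    let (x , y , x≢y , same , same') = twin-neighbours (N (Q fz)) (Q (fs fz))
    in ⊥-elim (not-resolving Q x≢y (λ { fz → same ; (fs fz) → same' }) resolving)
  resolving-size≥3 v N (suc (suc (suc l))) Q resolving = s≤s (s≤s (s≤s z≤n))

module _ (N k m : ℕ) where
  C□P□P : Graph
  C□P□P = (C (suc N) □ P k) □ P m

  C□P□P-symmetric : Symmetric C□P□P
  C□P□P-symmetric = □-symmetric (C (suc N) □ P k) (P m)
    (□-symmetric (C (suc N)) (P k) (C-symmetric (suc N)) (P-symmetric k)) (P-symmetric m)

  C□P□P-dist : V C□P□P → V C□P□P → ℕ
  C□P□P-dist = □-dist (C (suc N) □ P k) (P m) (□-dist (C (suc N)) (P k) C-dist path-dist) path-dist

  C□P□P-isDistance : IsDistance C□P□P C□P□P-dist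
  C□P□P-isDistance = □-isDistance (□-isDistance (C-isDistance N) (P-isDistance k)) (P-isDistance m)

cyc-pred : ∀ {N} → Fin (suc N) → Fin (suc N)
cyc-pred {N} fz = fromℕ N
cyc-pred (fs i) = inject₁ i

cyc-succ : ∀ {N} → Fin (suc N) → Fin (suc N)
cyc-succ {N} a with suc (toℕ a) <? suc N
... | yes a+1<n = fromℕ< a+1<n
... | no _      = fz

cyc-pred-adjacent : ∀ {N} (a : Fin (suc N)) → CycAdj (suc N) (cyc-pred a) a
cyc-pred-adjacent {N} fz = inj₁ (inj₂ (cong suc (toℕ-fromℕ N) , refl))
cyc-pred-adjacent (fs i) = inj₁ (inj₁ (cong suc (toℕ-inject₁ i)))

cyc-succ-adjacent : ∀ {N} (a : Fin (suc N)) → CycAdj (suc N) (cyc-succ a) a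
cyc-succ-adjacent {N} a with suc (toℕ a) <? suc N
... | yes a+1<n = inj₂ (inj₁ (sym (toℕ-fromℕ< a+1<n)))
... | no a+1≮n  = inj₂ (inj₂ (≤-antisym (toℕ<n a) (≮⇒≥ a+1≮n) , refl))

cyc-pred-≢ : ∀ {N} → 1 ≤ N → (a : Fin (suc N)) → cyc-pred a ≢ a
cyc-pred-≢ {N} 1≤N fz eq = <⇒≢ 1≤N (sym (trans (sym (toℕ-fromℕ N)) (cong toℕ eq)))
cyc-pred-≢ 1≤N (fs i) eq = 1+n≢n (sym (trans (sym (toℕ-inject₁ i)) (cong toℕ eq)))

cyc-succ-≢ : ∀ {N} → 1 ≤ N → (a : Fin (suc N)) → cyc-succ a ≢ a
cyc-succ-≢ {N} 1≤N a eq with suc (toℕ a) <? suc N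
... | yes a+1<n = 1+n≢n (trans (sym (toℕ-fromℕ< a+1<n)) (cong toℕ eq))
cyc-succ-≢ {N} 1≤N fz eq | no 1≮n = 1≮n (s≤s 1≤N)

cyc-succ≢pred : ∀ {N} → 2 ≤ N → (a : Fin (suc N)) → cyc-succ a ≢ cyc-pred a
cyc-succ≢pred {N} 2≤N a eq with suc (toℕ a) <? suc N
cyc-succ≢pred {N} 2≤N fz eq | yes 1<n = <⇒≢ 2≤N (trans (sym (toℕ-fromℕ< 1<n)) (trans (cong toℕ eq) (toℕ-fromℕ N)))
cyc-succ≢pred {N} 2≤N fz eq | no 1≮n = 1≮n (s≤s (≤-trans (s≤s z≤n) 2≤N))
cyc-succ≢pred {N} 2≤N (fs i) eq | yes i+2<n =
  m+1+n≢n 1 (trans (sym (toℕ-fromℕ< i+2<n)) (trans (cong toℕ eq) (toℕ-inject₁ i)))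
cyc-succ≢pred {N} 2≤N (fs i) eq | no i+2≮n = i+2≮n (s≤s (≤-trans (s≤s (s≤s (≤-reflexive i≡0))) 2≤N))
  where
  i≡0 : toℕ i ≡ 0
  i≡0 = trans (sym (toℕ-inject₁ i)) (cong toℕ (sym eq))

path-nbr : ∀ {K} → Fin (suc (suc K)) → Fin (suc (suc K))
path-nbr fz     = fs fz
path-nbr (fs i) = inject₁ i

path-nbr-adjacent : ∀ {K} (b : Fin (suc (suc K))) → PathAdj (suc (suc K)) (path-nbr b) b
path-nbr-adjacent fz     = inj₂ refl
path-nbr-adjacent (fs i) = inj₁ (cong suc (toℕ-inject₁ i))

path-nbr-≢ : ∀ {K} (b : Fin (suc (suc K))) → path-nbr b ≢ b
path-nbr-≢ (fs i) eq = 1+n≢n (sym (trans (sym (toℕ-inject₁ i)) (cong toℕ eq)))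

C□P□P-neighbours : ∀ {N K K'} → 2 ≤ N → (q : V (C□P□P N (suc (suc K)) (suc (suc K')))) →
  FourNeighbours (C□P□P N (suc (suc K)) (suc (suc K'))) q
C□P□P-neighbours {N} {K} {K'} 2≤N ((a , b) , c) = record
  { nbr          = nbr
  ; nbr-adjacent = adjacent
  ; nbr-≢        = ≢q
  ; nbr-distinct = distinct
  }
  where
  G : Graph
  G = C□P□P N (suc (suc K)) (suc (suc K'))
  1≤N : 1 ≤ N
  1≤N = ≤-trans (s≤s z≤n) 2≤N
  cyc : V G → Fin (suc N)
  cyc = proj₁ ∘ proj₁
  nbr : Fin 4 → V G
  nbr fz                = (cyc-succ a , b) , c
  nbr (fs fz)           = (cyc-pred a , b) , c
  nbr (fs (fs fz))      = (a , path-nbr b) , c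
  nbr (fs (fs (fs fz))) = (a , b) , path-nbr c
  adjacent : ∀ i → Adj G (nbr i) ((a , b) , c)
  adjacent fz                = inj₁ (refl , inj₁ (refl , cyc-succ-adjacent a))
  adjacent (fs fz)           = inj₁ (refl , inj₁ (refl , cyc-pred-adjacent a))
  adjacent (fs (fs fz))      = inj₁ (refl , inj₂ (refl , path-nbr-adjacent b))
  adjacent (fs (fs (fs fz))) = inj₂ (refl , path-nbr-adjacent c)
  ≢q : ∀ i → nbr i ≢ ((a , b) , c)
  ≢q fz                = cyc-succ-≢ 1≤N a ∘ cong cyc
  ≢q (fs fz)           = cyc-pred-≢ 1≤N a ∘ cong cyc
  ≢q (fs (fs fz))      = path-nbr-≢ b ∘ cong (proj₂ ∘ proj₁)
  ≢q (fs (fs (fs fz))) = path-nbr-≢ c ∘ cong proj₂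
  distinct : ∀ {i j} → i Fin.< j → nbr i ≢ nbr j
  distinct {fz}           {fs fz}           _ = cyc-succ≢pred 2≤N a ∘ cong cyc
  distinct {fz}           {fs (fs fz)}      _ = cyc-succ-≢ 1≤N a ∘ cong cyc
  distinct {fz}           {fs (fs (fs fz))} _ = cyc-succ-≢ 1≤N a ∘ cong cyc
  distinct {fs fz}        {fs (fs fz)}      _ = cyc-pred-≢ 1≤N a ∘ cong cyc
  distinct {fs fz}        {fs (fs (fs fz))} _ = cyc-pred-≢ 1≤N a ∘ cong cyc
  distinct {fs (fs fz)}   {fs (fs (fs fz))} _ = path-nbr-≢ c ∘ sym ∘ cong proj₂
  distinct {fs fz}        {fs fz}           (s≤s ())
  distinct {fs (fs _)}    {fs fz}           (s≤s ())
  distinct {fs (fs _)}    {fs (fs fz)}      (s≤s (s≤s ()))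
  distinct {fs (fs (fs _))} {fs (fs (fs fz))} (s≤s (s≤s (s≤s ())))

C□P□P-resolving-size≥3 : ∀ N K K' → 2 ≤ N → ∀ l (Q : Fin l → V (C□P□P N (suc (suc K)) (suc (suc K')))) →
  Resolving (C□P□P N (suc (suc K)) (suc (suc K'))) Q → 3 ≤ l
C□P□P-resolving-size≥3 N K K' 2≤N =
  resolving-size≥3 (C□P□P N k m) (C□P□P-symmetric N k m) (C□P□P-isDistance N k m)
    ((fz , fz) , fz) (C□P□P-neighbours 2≤N)
  where
  k m : ℕ
  k = suc (suc K)
  m = suc (suc K')

cyc-dist-short : ∀ {n} a j {δ} → ∣ a - j ∣ ≡ δ → δ + δ ≤ n → cyc-dist n a j ≡ δ
cyc-dist-short a j refl δ+δ≤n = m≤n⇒m⊓n≡m (m+n≤o⇒m≤o∸n _ δ+δ≤n)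

cyc-dist-long : ∀ {n} a j {δ} → ∣ a - j ∣ ≡ δ → n ≤ δ + δ → cyc-dist n a j ≡ n ∸ δ
cyc-dist-long {n} a j refl n≤δ+δ = m≥n⇒m⊓n≡n (m≤n+o⇒m∸n≤o n _ n≤δ+δ)

-- Identities between differences, stated without subtraction.
+-cross : ∀ x x' y y' {β β'} → x + β ≡ x' + β' → y + β ≡ y' + β' → x + y' ≡ x' + y
+-cross x x' y y' {β} {β'} e e' = +-cancelʳ-≡ (β + β') _ _ (begin
  x + y' + (β + β')     ≡⟨ shuffle x y' β β' ⟩
  x + β + (y' + β')     ≡⟨ cong₂ _+_ e (sym e') ⟩
  x' + β' + (y + β)     ≡⟨ shuffle x' β' y β ⟩
  x' + y + (β' + β)     ≡⟨ cong (x' + y +_) (+-comm β' β) ⟩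
  x' + y + (β + β')     ∎)
  where
  open ≡-Reasoning
  shuffle : ∀ a b c d → a + b + (c + d) ≡ a + c + (b + d)
  shuffle = solve-∀

+-differences : ∀ u v p q u' v' p' q' → u + p ≡ v + q → u' + p' ≡ v' + q' → u + v' ≡ u' + v → q + p' ≡ q' + p
+-differences u v p q u' v' p' q' e e' e'' = +-cancelʳ-≡ (v + u') _ _ (begin
  q + p' + (v + u')     ≡⟨ shuffle₁ q p' v u' ⟩
  v + q + (u' + p')     ≡⟨ cong₂ _+_ (sym e) e' ⟩
  u + p + (v' + q')     ≡⟨ shuffle₂ u p v' q' ⟩
  u + v' + (p + q')     ≡⟨ cong (_+ (p + q')) e'' ⟩
  u' + v + (p + q')     ≡⟨ shuffle₃ u' v p q' ⟩
  q' + p + (v + u')     ∎)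
  where
  open ≡-Reasoning
  shuffle₁ : ∀ q p' v u' → q + p' + (v + u') ≡ v + q + (u' + p')
  shuffle₁ = solve-∀
  shuffle₂ : ∀ u p v' q' → u + p + (v' + q') ≡ u + v' + (p + q')
  shuffle₂ = solve-∀
  shuffle₃ : ∀ u' v p q' → u' + v + (p + q') ≡ q' + p + (v + u')
  shuffle₃ = solve-∀

module _ (h : ℕ) where
  private
    +-double : ∀ x a → x + a + a ≡ x + 2 * a
    +-double = solve-∀

    n : ℕ
    n = suc (2 * h)

    2h≡h+h : 2 * h ≡ h + h
    2h≡h+h = cong (h +_) (+-identityʳ h)

    d₀ dₕ : ℕ → ℕ
    d₀ a = cyc-dist n a 0
    dₕ a = cyc-dist n a h

    h+h≤n : h + h ≤ n
    h+h≤n = ≤-trans (≤-reflexive (sym 2h≡h+h)) (n≤1+n (2 * h))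

  -- d(a,0) - d(a,h) is 2a - h for a ≤ h and 3h + 1 - 2a beyond; the two values differ in parity.
  cyc-dist-landmarks : ∀ a → a ≤ 2 * h →
    d₀ a + h ≡ dₕ a + 2 * a ⊎ d₀ a + 2 * a ≡ dₕ a + suc (3 * h)
  cyc-dist-landmarks a a≤2h with a ≤? h
  ... | yes a≤h = inj₁ (begin
    d₀ a + h        ≡⟨ cong (_+ h) (cyc-dist-short a 0 (∣-∣-identityʳ a) (≤-trans (+-mono-≤ a≤h a≤h) h+h≤n)) ⟩
    a + h           ≡⟨ +-comm a h ⟩
    h + a           ≡⟨ cong (_+ a) (sym (m∸n+n≡m a≤h)) ⟩
    h ∸ a + a + a   ≡⟨ +-double (h ∸ a) a ⟩
    h ∸ a + 2 * a   ≡⟨ cong (_+ 2 * a) (sym (cyc-dist-short a h (m≤n⇒∣m-n∣≡n∸m a≤h) h-a+h-a≤n)) ⟩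
    dₕ a + 2 * a    ∎)
    where
    open ≡-Reasoning
    h-a+h-a≤n : h ∸ a + (h ∸ a) ≤ n
    h-a+h-a≤n = ≤-trans (+-mono-≤ (m∸n≤m h a) (m∸n≤m h a)) h+h≤n
  ... | no a≰h = inj₂ (begin
    d₀ a + 2 * a          ≡⟨ cong (_+ 2 * a) (cyc-dist-long a 0 (∣-∣-identityʳ a) n≤a+a) ⟩
    n ∸ a + 2 * a         ≡⟨ sym (+-double (n ∸ a) a) ⟩
    n ∸ a + a + a         ≡⟨ cong (_+ a) (m∸n+n≡m a≤n) ⟩
    n + a                 ≡⟨ cong (n +_) (sym (m∸n+n≡m h≤a)) ⟩
    n + (a ∸ h + h)       ≡⟨ rearrange h (a ∸ h) ⟩
    a ∸ h + suc (3 * h)   ≡⟨ cong (_+ suc (3 * h)) (sym (cyc-dist-short a h (m≤n⇒∣n-m∣≡n∸m h≤a) a-h+a-h≤n)) ⟩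
    dₕ a + suc (3 * h)    ∎)
    where
    open ≡-Reasoning
    h<a : h < a
    h<a = ≰⇒> a≰h
    h≤a : h ≤ a
    h≤a = <⇒≤ h<a
    a≤n : a ≤ n
    a≤n = ≤-trans a≤2h (n≤1+n (2 * h))
    n≤a+a : n ≤ a + a
    n≤a+a = ≤-trans (s≤s (≤-reflexive 2h≡h+h)) (+-mono-≤ h<a h≤a)
    a-h+a-h≤n : a ∸ h + (a ∸ h) ≤ n
    a-h+a-h≤n = ≤-trans (+-mono-≤ a-h≤h a-h≤h) h+h≤n
      where
      a-h≤h : a ∸ h ≤ h
      a-h≤h = m≤n+o⇒m∸n≤o a h (≤-trans a≤2h (≤-reflexive 2h≡h+h))
    rearrange : ∀ h d → suc (2 * h) + (d + h) ≡ d + suc (3 * h)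
    rearrange = solve-∀

  private
    landmark-relations-incompatible : ∀ a a' →
      d₀ a + h ≡ dₕ a + 2 * a →
      d₀ a' + 2 * a' ≡ dₕ a' + suc (3 * h) →
      d₀ a + dₕ a' ≡ d₀ a' + dₕ a → ⊥
    landmark-relations-incompatible a a' e e' cross =
      even≢odd (a + a') (2 * h) (begin
        2 * (a + a')          ≡⟨ left a a' ⟩
        2 * a + 2 * a'        ≡⟨ +-differences (d₀ a) (dₕ a) h (2 * a) (d₀ a') (dₕ a') (2 * a') (suc (3 * h)) e e' cross ⟩
        suc (3 * h) + h       ≡⟨ right h ⟩
        suc (2 * (2 * h))     ∎)
      where
      open ≡-Reasoning
      left : ∀ a a' → 2 * (a + a') ≡ 2 * a + 2 * a'
      left = solve-∀
      right : ∀ h → suc (3 * h) + h ≡ suc (2 * (2 * h))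
      right = solve-∀

  cyc-landmarks-separate : ∀ {a a' β β'} → a ≤ 2 * h → a' ≤ 2 * h →
    d₀ a + β ≡ d₀ a' + β' → dₕ a + β ≡ dₕ a' + β' → a ≡ a'
  cyc-landmarks-separate {a} {a'} a≤2h a'≤2h e₀ eₕ =
    separate (cyc-dist-landmarks a a≤2h) (cyc-dist-landmarks a' a'≤2h)
    where
    cross : d₀ a + dₕ a' ≡ d₀ a' + dₕ a
    cross = +-cross (d₀ a) (d₀ a') (dₕ a) (dₕ a') e₀ eₕ
    Relation : ℕ → Set
    Relation a = d₀ a + h ≡ dₕ a + 2 * a ⊎ d₀ a + 2 * a ≡ dₕ a + suc (3 * h)
    separate : Relation a → Relation a' → a ≡ a'
    separate (inj₁ e) (inj₁ e') = *-cancelˡ-≡ a a' 2 (+-cancelʳ-≡ h _ _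
      (+-differences (d₀ a) (dₕ a) h (2 * a) (d₀ a') (dₕ a') h (2 * a') e e' cross))
    separate (inj₂ e) (inj₂ e') = sym (*-cancelˡ-≡ a' a 2 (+-cancelˡ-≡ (suc (3 * h)) _ _
      (+-differences (d₀ a) (dₕ a) (2 * a) (suc (3 * h)) (d₀ a') (dₕ a') (2 * a') (suc (3 * h)) e e' cross)))
    separate (inj₁ e) (inj₂ e') = ⊥-elim (landmark-relations-incompatible a a' e e' cross)
    separate (inj₂ e) (inj₁ e') = ⊥-elim (landmark-relations-incompatible a' a e' e (sym cross))

P₂-separated : ∀ {X Y} (c c' : Fin 2) →
  X + ∣ toℕ c - 0 ∣ ≡ Y + ∣ toℕ c' - 0 ∣ → X + ∣ toℕ c - 1 ∣ ≡ Y + ∣ toℕ c' - 1 ∣ → c ≡ c'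
P₂-separated fz           fz           _ _ = refl
P₂-separated (fs fz)      (fs fz)      _ _ = refl
P₂-separated {X} {Y} fz (fs fz) e e' = ⊥-elim (m+1+n≢n 1 (begin
  2 + Y    ≡⟨ +-comm 1 (suc Y) ⟩
  suc Y + 1 ≡⟨ cong (_+ 1) (sym X≡1+Y) ⟩
  X + 1    ≡⟨ e' ⟩
  Y + 0    ≡⟨ +-identityʳ Y ⟩
  Y        ∎))
  where
  open ≡-Reasoning
  X≡1+Y : X ≡ suc Y
  X≡1+Y = trans (sym (+-identityʳ X)) (trans e (+-comm Y 1))
P₂-separated (fs fz) fz e e' = sym (P₂-separated fz (fs fz) e' e)

module _ (h K : ℕ) (1≤h : 1 ≤ h) where
  private
    N : ℕ
    N = 2 * h
    G : Graph
    G = C□P□P N (suc K) 2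
    h<1+N : h < suc N
    h<1+N = s≤s (m≤m+n h (h + 0))

  landmarks : Fin 3 → V G
  landmarks fz           = (fz , fz) , fz
  landmarks (fs fz)      = (fz , fz) , fs fz
  landmarks (fs (fs fz)) = (fromℕ< h<1+N , fz) , fz

  landmarks-injective : Injective _≡_ _≡_ landmarks
  landmarks-injective {fz}         {fz}         _  = refl
  landmarks-injective {fs fz}      {fs fz}      _  = refl
  landmarks-injective {fs (fs fz)} {fs (fs fz)} _  = refl
  landmarks-injective {fz}         {fs (fs fz)} eq = ⊥-elim (h≢0 (sym (cong (proj₁ ∘ proj₁) eq)))
    where h≢0 : fromℕ< h<1+N ≢ fz
          h≢0 h≡0 = <⇒≢ 1≤h (sym (trans (sym (toℕ-fromℕ< h<1+N)) (cong toℕ h≡0)))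
  landmarks-injective {fs (fs fz)} {fz}         eq = sym (landmarks-injective (sym eq))
  landmarks-injective {fs fz}      {fs (fs fz)} ()

  landmarks-resolving : Resolving G landmarks
  landmarks-resolving ((a , b) , c) ((a' , b') , c') same
    with P₂-separated c c' (dist≡ fz) (dist≡ (fs fz)) | dist≡ fz | dist≡ (fs (fs fz))
    where
    dist≡ : ∀ i → C□P□P-dist N (suc K) 2 ((a , b) , c) (landmarks i)
                ≡ C□P□P-dist N (suc K) 2 ((a' , b') , c') (landmarks i)
    dist≡ = SameRep⇒dist≡ (C□P□P-isDistance N (suc K) 2) landmarks same
  ... | refl | e₀ | eₕ = cong₂ (λ a b → (a , b) , c) (toℕ-injective a≡a') (toℕ-injective b≡b')
    where
    β β' : ℕ
    β  = ∣ toℕ b - 0 ∣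
    β' = ∣ toℕ b' - 0 ∣
    e₀' : cyc-dist (suc N) (toℕ a) 0 + β ≡ cyc-dist (suc N) (toℕ a') 0 + β'
    e₀' = +-cancelʳ-≡ ∣ toℕ c - 0 ∣ _ _ e₀
    eₕ' : cyc-dist (suc N) (toℕ a) h + β ≡ cyc-dist (suc N) (toℕ a') h + β'
    eₕ' = subst (λ j → cyc-dist (suc N) (toℕ a) j + β ≡ cyc-dist (suc N) (toℕ a') j + β')
            (toℕ-fromℕ< h<1+N) (+-cancelʳ-≡ ∣ toℕ c - 0 ∣ _ _ eₕ)
    a≡a' : toℕ a ≡ toℕ a'
    a≡a' = cyc-landmarks-separate h (≤-pred (toℕ<n a)) (≤-pred (toℕ<n a')) e₀' eₕ'
    b≡b' : toℕ b ≡ toℕ b'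
    b≡b' = begin
      toℕ b    ≡⟨ sym (∣-∣-identityʳ (toℕ b)) ⟩
      β        ≡⟨ +-cancelˡ-≡ (cyc-dist (suc N) (toℕ a) 0) _ _
                    (trans e₀' (cong (λ t → cyc-dist (suc N) t 0 + β') (sym a≡a'))) ⟩
      β'       ≡⟨ ∣-∣-identityʳ (toℕ b') ⟩
      toℕ b'   ∎
      where open ≡-Reasoning

C□P□P₂-metricDim : ∀ h K → 1 ≤ h → MetricDim (C□P□P (2 * h) (suc (suc K)) 2) 3
C□P□P₂-metricDim h K 1≤h =
  (landmarks h (suc K) 1≤h , landmarks-injective h (suc K) 1≤h , landmarks-resolving h (suc K) 1≤h) ,
  λ l Q _ → C□P□P-resolving-size≥3 (2 * h) K 0 (*-monoʳ-≤ 2 1≤h) l Q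

n%2≡1⇒n≡1+2*[n/2] : ∀ n → n % 2 ≡ 1 → n ≡ suc (2 * (n / 2))
n%2≡1⇒n≡1+2*[n/2] n n%2≡1 = trans (m≡m%n+[m/n]*n n 2) (cong₂ _+_ n%2≡1 (*-comm (n / 2) 2))

theorem3p2 : (n k : ℕ) → 3 ≤ n → n % 2 ≡ 1 → 3 ≤ k →
    MetricDim ((C n □ P k) □ P 2) 3
theorem3p2 n (suc (suc (suc K))) 3≤n n-odd (s≤s (s≤s (s≤s _))) =
  subst (λ n → MetricDim ((C n □ P (suc (suc (suc K)))) □ P 2) 3) (sym n≡1+2h)
        (C□P□P₂-metricDim (n / 2) (suc K) (*-cancelˡ-≤ 2 (≤-pred (subst (3 ≤_) n≡1+2h 3≤n))))
  where
  n≡1+2h : n ≡ suc (2 * (n / 2))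
  n≡1+2h = n%2≡1⇒n≡1+2*[n/2] n n-odd
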